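{- Let $\Lambda$ be a finite connected cubic bipartite graph and let $G\le {\rm Aut}(\Lambda)$ act transitively on the $2$-darts of $\Lambda$. Let $H$ be the subgroup of $G$ consisting of those elements that preserve each of the two parts of the bipartition of $\Lambda$, and let $\alpha\in G\setminus H$. Let $G\wr C_2=(G\times G)\rtimes\langle t\rangle$ denote the wreath product, where $t$ is an involution with $t(g_1,g_2)t=(g_2,g_1)$ for all $g_1,g_2\in G$, and let $A=\langle H\times H,\ (\alpha,\alpha),\ (1,\alpha)t\rangle\le G\wr C_2$. Then the digraph $\mathrm{A^2D}(\Lambda)$ admits a dart-transitive group of symmetries isomorphic to $A$, and the graph $\mathrm{A^2G}(\Lambda)$ admits a dart-transitive group of symmetries isomorphic to $G\wr C_2$.
   Context: A digraph is a pair $({\mathcal V},{\mathcal D})$ with ${\mathcal V}$ a finite non-empty set of vertices and ${\mathcal D}$ a set of ordered pairs of distinct vertices (darts); a graph is a digraph with ${\mathcal D}={\mathcal D}^{ -1}$, where ${\mathcal D}^{ -1}=\{(v,u):(u,v)\in{\mathcal D}\}$. The underlying graph of a digraph $({\mathcal V},{\mathcal D})$ is $({\mathcal V},{\mathcal D}\cup{\mathcal D}^{ -1})$. A symmetry of a digraph is a permutation of its vertices preserving the dart set; a group of symmetries is dart-transitive if it is transitive on the darts. A $2$-dart of a graph $\Lambda$ is a pair $(x,y)$ of darts of $\Lambda$ such that the terminal vertex of $x$ equals the initial vertex of $y$ and the initial vertex of $x$ differs from the terminal vertex of $y$. For a graph $\Lambda$ with dart set ${\mathcal D}(\Lambda)$,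 $\mathrm{A^2D}(\Lambda)$ is the digraph with vertex set ${\mathcal D}(\Lambda)\times{\mathcal D}(\Lambda)$ in which $\bigl((x,y),(z,w)\bigr)$ is a dart if and only if $y=z$ and $(x,w)$ is a $2$-dart of $\Lambda$; $\mathrm{A^2G}(\Lambda)$ is the underlying graph of $\mathrm{A^2D}(\Lambda)$. -}

module Defs where

open import Data.Nat using (ℕ; zero; suc; _≤_)
open import Data.Bool using (Bool; true; false; T; not; _xor_; if_then_else_)
open import Data.Fin using (Fin)
open import Data.Fin.Permutation using (Permutation′; _⟨$⟩ʳ_; _∘ₚ_; flip; id; _≈_)
open import Data.List using (List; length; filter; allFin)
open import Data.Product using (Σ; ∃; ∃-syntax; _×_; _,_; proj₁; proj₂)
open import Data.Empty using (⊥)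
open import Data.Unit using (⊤)
open import Relation.Nullary using (¬_)
open import Relation.Nullary.Decidable using (T?)
open import Relation.Binary.PropositionalEquality using (_≡_; _≢_)
open import Function.Bundles using (_↔_; Inverse)

module _ {n : ℕ} (adj : Fin n → Fin n → Bool) where

  IsGraph : Set
  IsGraph = (∀ u v → adj u v ≡ adj v u) × (∀ u → adj u u ≡ false)

  degree : Fin n → ℕ
  degree v = length (filter (λ u → T? (adj v u)) (allFin n))

  Cubic : Set
  Cubic = ∀ v → degree v ≡ 3

  data Walk : Fin n → Fin n → Set where
    stay : ∀ {u} → Walk u u
    step : ∀ {u v w} → T (adj u v) → Walk v w → Walk u w

  Connected : Set
  Connected = ∀ u v → Walk u v

  -- proper 2-colouring = bipartition into the parts col⁻¹(false), col⁻¹(true)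
  ProperBipartition : (Fin n → Bool) → Set
  ProperBipartition col = ∀ u v → T (adj u v) → col u ≢ col v

  IsAut : Permutation′ n → Set
  IsAut g = ∀ u v → adj (g ⟨$⟩ʳ u) (g ⟨$⟩ʳ v) ≡ adj u v

  record IsAutSubgroup (G : Permutation′ n → Set) : Set where
    field
      resp   : ∀ {g h} → g ≈ h → G g → G h
      has-id : G id
      closed : ∀ {g h} → G g → G h → G (g ∘ₚ h)
      inv    : ∀ {g} → G g → G (flip g)
      auts   : ∀ {g} → G g → IsAut g

  Dart : Set
  Dart = Σ (Fin n × Fin n) (λ e → T (adj (proj₁ e) (proj₂ e)))

  init term : Dart → Fin n
  init d = proj₁ (proj₁ d)
  term d = proj₂ (proj₁ d)

  TwoDart : Dart → Dart → Set
  TwoDart x y = (term x ≡ init y) × (init x ≢ term y)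

  -- G is transitive on 2-darts (a 2-dart written as a vertex triple u ~ v ~ w, u ≠ w)
  TwoDartTransitive : (Permutation′ n → Set) → Set
  TwoDartTransitive G =
    ∀ (x y x′ y′ : Dart) → TwoDart x y → TwoDart x′ y′ →
    ∃[ g ] (G g × (g ⟨$⟩ʳ init x ≡ init x′) × (g ⟨$⟩ʳ term x ≡ term x′)
                 × (g ⟨$⟩ʳ term y ≡ term y′))

  A2DVertex : Set
  A2DVertex = Dart × Dart

  A2DDart : A2DVertex → A2DVertex → Set
  A2DDart (x , y) (z , w) = (y ≡ z) × TwoDart x w

  A2GDart : A2DVertex → A2DVertex → Set
  A2GDart p q = A2DDart p q Data.Sum.⊎ A2DDart q p
    where import Data.Sum

-- An element (g₁ , g₂ , b) stands for (g₁,g₂) t^b  (b = true means t).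
-- Product of permutations: g · h = "first h, then g" (= h ∘ₚ g in stdlib).

module _ {n : ℕ} where

  Perm = Permutation′ n

  _·_ : Perm → Perm → Perm
  g · h = h ∘ₚ g

  WrEl : Set
  WrEl = Perm × Perm × Bool

  InWr : (Perm → Set) → WrEl → Set
  InWr G (g₁ , g₂ , _) = G g₁ × G g₂

  -- (g₁,g₂)t^b · (h₁,h₂)t^c = (g₁,g₂)(t^b(h₁,h₂)t^b) t^(b+c)
  _⊙_ : WrEl → WrEl → WrEl
  (g₁ , g₂ , b) ⊙ (h₁ , h₂ , c) =
    (if b then g₁ · h₂ else g₁ · h₁) , (if b then g₂ · h₁ else g₂ · h₂) , (b xor c)

  wr-inv : WrEl → WrEl
  wr-inv (g₁ , g₂ , b) =
    (if b then flip g₂ else flip g₁) , (if b then flip g₁ else flip g₂) , b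

  wr-one : WrEl
  wr-one = id , id , false

  _≈W_ : WrEl → WrEl → Set
  (g₁ , g₂ , b) ≈W (h₁ , h₂ , c) = (g₁ ≈ h₁) × (g₂ ≈ h₂) × (b ≡ c)

  data InA (H : Perm → Set) (α : Perm) : WrEl → Set where
    genHH  : ∀ {h₁ h₂} → H h₁ → H h₂ → InA H α (h₁ , h₂ , false)
    genαα  : InA H α (α , α , false)
    gen1αt : InA H α (id , α , true)
    one    : InA H α wr-one
    mul    : ∀ {x y} → InA H α x → InA H α y → InA H α (x ⊙ y)
    inv    : ∀ {x} → InA H α x → InA H α (wr-inv x)
    resp   : ∀ {x y} → x ≈W y → InA H α x → InA H α y

-- "The (di)graph with vertex type V and dart relation R admits a
-- dart-transitive group of symmetries isomorphic to the group K"
-- (K = the elements of WrEl satisfying the predicate K, with ⊙, ≈W):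
-- there is a faithful action ρ of K on V by symmetries (bijections
-- preserving the dart set), i.e. an injective homomorphism K → Sym(V)
-- whose image (a group of symmetries ≅ K) is transitive on darts.

module _ {n : ℕ} where

  record AdmitsDartTransitive (V : Set) (R : V → V → Set)
                              (K : WrEl {n} → Set) : Set₁ where
    field
      ρ        : WrEl {n} → V ↔ V
      hom      : ∀ {x y} → K x → K y → ∀ p →
                   Inverse.to (ρ (x ⊙ y)) p ≡ Inverse.to (ρ x) (Inverse.to (ρ y) p)
      faithful : ∀ {x y} → K x → K y →
                   (∀ p → Inverse.to (ρ x) p ≡ Inverse.to (ρ y) p) → x ≈W y
      symm     : ∀ {x} → K x → ∀ p q →
                   (R p q → R (Inverse.to (ρ x) p) (Inverse.to (ρ x) q))
                 × (R (Inverse.to (ρ x) p) (Inverse.to (ρ x) q) → R p q)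
      trans    : ∀ p q p′ q′ → R p q → R p′ q′ →
                   ∃[ x ] (K x × (Inverse.to (ρ x) p ≡ p′) × (Inverse.to (ρ x) q ≡ q′))

module Submission where

-- A vertex (x , y) of A²D(Λ) straddles when x and y start in different parts of Λ.  Along a dart
-- (x , y) → (y , w) of A²D(Λ) the shared dart y changes coordinate and, Λ being bipartite, the
-- straddling bit flips.  Hence the coordinatewise action of (g₁ , g₂) tᵇ ∈ G ≀ C₂ on D(Λ) × D(Λ),
-- conjugated by the involution `untwist` that swaps the coordinates of straddling vertices, moves the
-- 2-dart (x , w) by one of g₁ , g₂ and the shared dart y by the other, so it maps darts of A²D(Λ)
-- to darts as soon as b = s(g₁) + s(g₂), where s(g) records whether g swaps the two parts.
-- Composing with the central involution reversing both darts whenever b + s(g₁) + s(g₂) = 1 gives a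
-- faithful action of all of G ≀ C₂, in which these elements reverse the darts of A²D(Λ) and so
-- preserve A²G(Λ).  The kernel of b + s(g₁) + s(g₂) is A.  Dart-transitivity comes from
-- 2-dart-transitivity of G, applied to the 2-dart (x , w) and to a 2-dart extending y.

open import Defs
open import Algebra.Bundles using (CommutativeRing)
open import Data.Bool using (Bool; true; false; T; not; _xor_)
open import Data.Bool.Properties
  using (T-irrelevant; ¬-not; xor-same; xor-comm; xor-assoc; xor-identityʳ; not-distribˡ-xor;
         not-distribʳ-xor; xor-annihilates-not; xor-∧-commutativeRing)
  renaming (_≟_ to _≟ᵇ_)
open import Algebra.Properties.CommutativeSemigroup
  (CommutativeRing.+-commutativeSemigroup xor-∧-commutativeRing) using (interchange; x∙yz≈y∙xz)
open import Data.Empty using (⊥-elim)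
open import Data.Fin using (Fin; fromℕ<; _≟_)
open import Data.Fin.Properties using (all?; any?)
open import Data.Fin.Permutation using (Permutation′; _⟨$⟩ʳ_; flip; id; _≈_; inverseˡ; inverseʳ)
open import Data.List using (List; length; allFin)
open import Data.List.Relation.Unary.All using (All; []; _∷_)
import Data.List.Relation.Unary.All as All
open import Data.List.Relation.Unary.All.Properties using (all-filter)
open import Data.List.Relation.Unary.AllPairs using ([]; _∷_)
open import Data.List.Relation.Unary.Unique.Propositional using (Unique)
open import Data.List.Relation.Unary.Unique.Propositional.Properties using (allFin⁺; filter⁺)
open import Data.Nat using (ℕ; _≤_; z≤n; s≤s)
open import Data.Nat.Properties using (≤-trans)
open import Data.Product using (∃-syntax; _×_; _,_; proj₁; proj₂; swap; map)
open import Data.Sum using (inj₁; inj₂)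
open import Function.Bundles using (_↔_; Inverse; Injection; mk↔ₛ′)
open import Function.Properties.Inverse using (↔⇒↣)
open import Relation.Nullary using (¬_; Dec; yes; no; ¬?)
open import Relation.Nullary.Decidable using (T?; _×-dec_; decidable-stable)
open import Relation.Binary.PropositionalEquality hiding (resp)
open ≡-Reasoning

xor-xor-cancelʳ : ∀ a b → (a xor b) xor b ≡ a
xor-xor-cancelʳ a b = begin
  (a xor b) xor b ≡⟨ xor-assoc a b b ⟩
  a xor (b xor b) ≡⟨ cong (a xor_) (xor-same b) ⟩
  a xor false     ≡⟨ xor-identityʳ a ⟩
  a               ∎

⟨$⟩ʳ-injective : ∀ {n} (g : Permutation′ n) {u v} → g ⟨$⟩ʳ u ≡ g ⟨$⟩ʳ v → u ≡ v
⟨$⟩ʳ-injective g = Injection.injective (↔⇒↣ g)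

unique-constant⇒length≤1 : ∀ {A : Set} {u : A} {xs : List A} → Unique xs → All (_≡ u) xs → length xs ≤ 1
unique-constant⇒length≤1 [] [] = z≤n
unique-constant⇒length≤1 ([] ∷ []) (_ ∷ []) = s≤s z≤n
unique-constant⇒length≤1 ((x≢y ∷ _) ∷ _) (x≡u ∷ y≡u ∷ _) = ⊥-elim (x≢y (trans x≡u (sym y≡u)))

module Darts {n : ℕ} (adj : Fin n → Fin n → Bool) where

  dart-≡ : {d d′ : Dart adj} → proj₁ d ≡ proj₁ d′ → d ≡ d′
  dart-≡ {_ , t} {_ , t′} refl = cong (_ ,_) (T-irrelevant t t′)

  isAut? : (g : Permutation′ n) → Dec (IsAut adj g)
  isAut? g = all? λ u → all? λ v → adj (g ⟨$⟩ʳ u) (g ⟨$⟩ʳ v) ≟ᵇ adj u v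

  isAut-id : IsAut adj id
  isAut-id u v = refl

  isAut-· : ∀ {g h} → IsAut adj g → IsAut adj h → IsAut adj (g · h)
  isAut-· {g} {h} aut-g aut-h u v = trans (aut-g (h ⟨$⟩ʳ u) (h ⟨$⟩ʳ v)) (aut-h u v)

  isAut-flip : ∀ {g} → IsAut adj g → IsAut adj (flip g)
  isAut-flip {g} aut-g u v = trans (sym (aut-g _ _)) (cong₂ adj (inverseʳ g) (inverseʳ g))

  -- Darts not mapped to darts (possible only when g is not an automorphism) are left fixed.
  act : Permutation′ n → Dart adj → Dart adj
  act g ((u , v) , uv) with T? (adj (g ⟨$⟩ʳ u) (g ⟨$⟩ʳ v))
  ... | yes guv = (g ⟨$⟩ʳ u , g ⟨$⟩ʳ v) , guv
  ... | no  _   = (u , v) , uv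

  act-ends : ∀ {g} → IsAut adj g → ∀ d → proj₁ (act g d) ≡ map (g ⟨$⟩ʳ_) (g ⟨$⟩ʳ_) (proj₁ d)
  act-ends {g} aut-g ((u , v) , uv) with T? (adj (g ⟨$⟩ʳ u) (g ⟨$⟩ʳ v))
  ... | yes _   = refl
  ... | no ¬guv = ⊥-elim (¬guv (subst T (sym (aut-g u v)) uv))

  act-init : ∀ {g} → IsAut adj g → ∀ d → init adj (act g d) ≡ g ⟨$⟩ʳ init adj d
  act-init aut-g d = cong proj₁ (act-ends aut-g d)

  act-term : ∀ {g} → IsAut adj g → ∀ d → term adj (act g d) ≡ g ⟨$⟩ʳ term adj d
  act-term aut-g d = cong proj₂ (act-ends aut-g d)

  act-≡ : ∀ {g} → IsAut adj g → ∀ {d d′} → g ⟨$⟩ʳ init adj d ≡ init adj d′ →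
          g ⟨$⟩ʳ term adj d ≡ term adj d′ → act g d ≡ d′
  act-≡ aut-g {d} e₁ e₂ = dart-≡ (trans (act-ends aut-g d) (cong₂ _,_ e₁ e₂))

  act-id : ∀ d → act id d ≡ d
  act-id d = act-≡ isAut-id refl refl

  act-· : ∀ {g h} → IsAut adj g → IsAut adj h → ∀ d → act (g · h) d ≡ act g (act h d)
  act-· {g} {h} aut-g aut-h d = dart-≡ (begin
    proj₁ (act (g · h) d)               ≡⟨ act-ends (isAut-· {g} {h} aut-g aut-h) d ⟩
    move g (move h (proj₁ d))           ≡⟨ cong (move g) (act-ends aut-h d) ⟨
    move g (proj₁ (act h d))            ≡⟨ act-ends aut-g (act h d) ⟨
    proj₁ (act g (act h d))             ∎)
    where move = λ k → map (k ⟨$⟩ʳ_) (k ⟨$⟩ʳ_)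

  act-cong : ∀ {g h} → IsAut adj g → IsAut adj h → g ≈ h → ∀ d → act g d ≡ act h d
  act-cong aut-g aut-h g≈h d = act-≡ aut-g (trans (g≈h _) (sym (act-init aut-h d)))
                                            (trans (g≈h _) (sym (act-term aut-h d)))

  avoiding-neighbour : ∀ {v} → 2 ≤ degree adj v → ∀ u → ∃[ w ] (T (adj v w) × w ≢ u)
  avoiding-neighbour {v} 2≤deg u with any? (λ w → T? (adj v w) ×-dec ¬? (w ≟ u))
  ... | yes found = found
  ... | no none = ⊥-elim (2≰1 (≤-trans 2≤deg (unique-constant⇒length≤1
          (filter⁺ neighbour? (allFin⁺ n)) (All.map only-u (all-filter neighbour? (allFin n))))))
    where
      neighbour? = λ w → T? (adj v w)
      only-u : ∀ {w} → T (adj v w) → w ≡ u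
      only-u {w} t = decidable-stable (w ≟ u) (λ w≢u → none (w , t , w≢u))
      2≰1 : ¬ (2 ≤ 1)
      2≰1 (s≤s ())

module Reversal {n : ℕ} (adj : Fin n → Fin n → Bool) (adj-sym : ∀ u v → adj u v ≡ adj v u) where

  open Darts adj

  reverse : Dart adj → Dart adj
  reverse ((u , v) , uv) = (v , u) , subst T (adj-sym u v) uv

  reverse-involutive : ∀ d → reverse (reverse d) ≡ d
  reverse-involutive d = dart-≡ refl

  act-reverse : ∀ {g} → IsAut adj g → ∀ d → act g (reverse d) ≡ reverse (act g d)
  act-reverse aut-g d = dart-≡ (trans (act-ends aut-g (reverse d)) (cong swap (sym (act-ends aut-g d))))

module Parity {n : ℕ} (adj : Fin n → Fin n → Bool) (connected : Connected adj)
              (col : Fin n → Bool) (bipartition : ProperBipartition adj col) (v₀ : Fin n) where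

  swaps : Permutation′ n → Bool
  swaps g = col (g ⟨$⟩ʳ v₀) xor col v₀

  col-term : ∀ (d : Dart adj) → col (term adj d) ≡ not (col (init adj d))
  col-term ((u , v) , uv) = ¬-not (≢-sym (bipartition u v uv))

  private
    colourShift : Permutation′ n → Fin n → Bool
    colourShift g v = col (g ⟨$⟩ʳ v) xor col v

    colourShift-walk : ∀ {g} → IsAut adj g → ∀ {u w} → Walk adj u w → colourShift g u ≡ colourShift g w
    colourShift-walk aut-g stay = refl
    colourShift-walk {g} aut-g (step {u} {v} uv walk) = trans edge (colourShift-walk {g} aut-g walk)
      where
        edge : colourShift g u ≡ colourShift g v
        edge = sym (trans (cong₂ _xor_ (col-term ((g ⟨$⟩ʳ u , g ⟨$⟩ʳ v) , subst T (sym (aut-g u v)) uv))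
                                        (col-term ((u , v) , uv)))
                          (xor-annihilates-not (col (g ⟨$⟩ʳ u)) (col u)))

  col-act : ∀ g → IsAut adj g → ∀ v → col (g ⟨$⟩ʳ v) ≡ swaps g xor col v
  col-act g aut-g v = begin
    col (g ⟨$⟩ʳ v)                   ≡⟨ xor-xor-cancelʳ _ (col v) ⟨
    colourShift g v xor col v        ≡⟨ cong (_xor col v) (colourShift-walk {g} aut-g (connected v v₀)) ⟩
    swaps g xor col v                ∎

  swaps-id : swaps id ≡ false
  swaps-id = xor-same (col v₀)

  swaps-· : ∀ g h → IsAut adj g → swaps (g · h) ≡ swaps g xor swaps h
  swaps-· g h aut-g = trans (cong (_xor col v₀) (col-act g aut-g (h ⟨$⟩ʳ v₀)))
                            (xor-assoc (swaps g) (col (h ⟨$⟩ʳ v₀)) (col v₀))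

  swaps-cong : ∀ {g h} → g ≈ h → swaps g ≡ swaps h
  swaps-cong g≈h = cong (λ u → col u xor col v₀) (g≈h v₀)

  swaps-flip : ∀ g → IsAut adj g → swaps (flip g) ≡ swaps g
  swaps-flip g aut-g = begin
    col u xor col v₀               ≡⟨ cong (λ w → col u xor col w) (inverseʳ g) ⟨
    col u xor col (g ⟨$⟩ʳ u)       ≡⟨ cong (col u xor_) (col-act g aut-g u) ⟩
    col u xor (swaps g xor col u)  ≡⟨ xor-comm (col u) _ ⟩
    (swaps g xor col u) xor col u  ≡⟨ xor-xor-cancelʳ _ _ ⟩
    swaps g                        ∎
    where u = flip g ⟨$⟩ʳ v₀

module _ {n : ℕ} {P : Perm {n} → Set} where

  InWr-⊙ : (∀ {g h} → P g → P h → P (g · h)) →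
           ∀ w w′ → InWr P w → InWr P w′ → InWr P (w ⊙ w′)
  InWr-⊙ P-· (_ , _ , false) _ (p₁ , p₂) (q₁ , q₂) = P-· p₁ q₁ , P-· p₂ q₂
  InWr-⊙ P-· (_ , _ , true)  _ (p₁ , p₂) (q₁ , q₂) = P-· p₁ q₂ , P-· p₂ q₁

  InWr-inv : (∀ {g} → P g → P (flip g)) → ∀ w → InWr P w → InWr P (wr-inv w)
  InWr-inv P-flip (_ , _ , false) (p₁ , p₂) = P-flip p₁ , P-flip p₂
  InWr-inv P-flip (_ , _ , true)  (p₁ , p₂) = P-flip p₂ , P-flip p₁

  InWr-resp : (∀ {g h} → g ≈ h → P g → P h) → ∀ w w′ → w ≈W w′ → InWr P w → InWr P w′
  InWr-resp P-resp _ _ (g₁≈h₁ , g₂≈h₂ , _) (p₁ , p₂) = P-resp g₁≈h₁ p₁ , P-resp g₂≈h₂ p₂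

⊙-inverseʳ : ∀ {n} (w : WrEl {n}) → (w ⊙ wr-inv w) ≈W wr-one
⊙-inverseʳ (g₁ , g₂ , false) = (λ _ → inverseʳ g₁) , (λ _ → inverseʳ g₂) , refl
⊙-inverseʳ (g₁ , g₂ , true)  = (λ _ → inverseʳ g₁) , (λ _ → inverseʳ g₂) , refl

⊙-inverseˡ : ∀ {n} (w : WrEl {n}) → (wr-inv w ⊙ w) ≈W wr-one
⊙-inverseˡ (g₁ , g₂ , false) = (λ _ → inverseˡ g₁) , (λ _ → inverseˡ g₂) , refl
⊙-inverseˡ (g₁ , g₂ , true)  = (λ _ → inverseˡ g₂) , (λ _ → inverseˡ g₁) , refl

module A2DAction {n : ℕ} (adj : Fin n → Fin n → Bool) (adj-sym : ∀ u v → adj u v ≡ adj v u)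
                 (connected : Connected adj) (col : Fin n → Bool)
                 (bipartition : ProperBipartition adj col) (v₀ : Fin n)
                 (avoid : ∀ v u → ∃[ w ] (T (adj v w) × w ≢ u)) where

  open Darts adj
  open Reversal adj adj-sym
  open Parity adj connected col bipartition v₀

  straddles : A2DVertex adj → Bool
  straddles (x , y) = col (init adj x) xor col (init adj y)

  swapIf : Bool → A2DVertex adj → A2DVertex adj
  swapIf false q = q
  swapIf true  q = swap q

  untwist : A2DVertex adj → A2DVertex adj
  untwist q = swapIf (straddles q) q

  reverseIf : Bool → Dart adj → Dart adj
  reverseIf false d = d
  reverseIf true  d = reverse d

  reverseBoth : Bool → A2DVertex adj → A2DVertex adj
  reverseBoth e = map (reverseIf e) (reverseIf e)

  pairAct : Permutation′ n → Permutation′ n → A2DVertex adj → A2DVertex adj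
  pairAct g₁ g₂ = map (act g₁) (act g₂)

  wreathAct : WrEl {n} → A2DVertex adj → A2DVertex adj
  wreathAct (g₁ , g₂ , b) q = pairAct g₁ g₂ (swapIf b q)

  partSwap : WrEl {n} → Bool
  partSwap (g₁ , g₂ , _) = swaps g₁ xor swaps g₂

  -- Its kernel is the group A of the theorem; elements outside it reverse the darts of A²D(Λ).
  orientation : WrEl {n} → Bool
  orientation w = proj₂ (proj₂ w) xor partSwap w

  a2dAct : WrEl {n} → A2DVertex adj → A2DVertex adj
  a2dAct w q = untwist (wreathAct w (untwist (reverseBoth (orientation w) q)))

  swapIf-swapIf : ∀ b c q → swapIf b (swapIf c q) ≡ swapIf (b xor c) q
  swapIf-swapIf false c     q = refl
  swapIf-swapIf true  false q = refl
  swapIf-swapIf true  true  q = refl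

  swapIf-swap : ∀ b q → swapIf b (swap q) ≡ swap (swapIf b q)
  swapIf-swap false q = refl
  swapIf-swap true  q = refl

  swapIf-diagonal : ∀ b d → swapIf b (d , d) ≡ (d , d)
  swapIf-diagonal false d = refl
  swapIf-diagonal true  d = refl

  swapIf-reverseBoth : ∀ b e q → swapIf b (reverseBoth e q) ≡ reverseBoth e (swapIf b q)
  swapIf-reverseBoth false e q = refl
  swapIf-reverseBoth true  e q = refl

  straddles-swap : ∀ q → straddles (swap q) ≡ straddles q
  straddles-swap (x , y) = xor-comm (col (init adj y)) (col (init adj x))

  straddles-swapIf : ∀ b q → straddles (swapIf b q) ≡ straddles q
  straddles-swapIf false q = refl
  straddles-swapIf true  q = straddles-swap q

  straddles-reverseBoth : ∀ e q → straddles (reverseBoth e q) ≡ straddles q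
  straddles-reverseBoth false q       = refl
  straddles-reverseBoth true  (x , y) =
    trans (cong₂ _xor_ (col-term x) (col-term y)) (xor-annihilates-not (col (init adj x)) (col (init adj y)))

  straddles-pairAct : ∀ {g₁ g₂} → IsAut adj g₁ → IsAut adj g₂ → ∀ q →
                      straddles (pairAct g₁ g₂ q) ≡ straddles q xor (swaps g₁ xor swaps g₂)
  straddles-pairAct {g₁} {g₂} aut₁ aut₂ (x , y) = begin
    col (init adj (act g₁ x)) xor col (init adj (act g₂ y))
      ≡⟨ cong₂ (λ u v → col u xor col v) (act-init aut₁ x) (act-init aut₂ y) ⟩
    col (g₁ ⟨$⟩ʳ init adj x) xor col (g₂ ⟨$⟩ʳ init adj y)
      ≡⟨ cong₂ _xor_ (col-act g₁ aut₁ _) (col-act g₂ aut₂ _) ⟩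
    (swaps g₁ xor col (init adj x)) xor (swaps g₂ xor col (init adj y))
      ≡⟨ interchange (swaps g₁) _ (swaps g₂) _ ⟩
    (swaps g₁ xor swaps g₂) xor straddles (x , y)
      ≡⟨ xor-comm (swaps g₁ xor swaps g₂) _ ⟩
    straddles (x , y) xor (swaps g₁ xor swaps g₂) ∎

  straddles-dart : ∀ {p q} → A2DDart adj p q → straddles q ≡ not (straddles p)
  straddles-dart {x , y} {.y , z} (refl , x→z , _) = begin
    col (init adj y) xor col (init adj z)       ≡⟨ cong (λ u → col (init adj y) xor col u) x→z ⟨
    col (init adj y) xor col (term adj x)       ≡⟨ cong (col (init adj y) xor_) (col-term x) ⟩
    col (init adj y) xor not (col (init adj x)) ≡⟨ not-distribʳ-xor (col (init adj y)) _ ⟨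
    not (col (init adj y) xor col (init adj x)) ≡⟨ cong not (straddles-swap (x , y)) ⟩
    not (straddles (x , y))                     ∎

  untwist-involutive : ∀ q → untwist (untwist q) ≡ q
  untwist-involutive q = begin
    swapIf (straddles (untwist q)) (untwist q)
      ≡⟨ cong (λ b → swapIf b (untwist q)) (straddles-swapIf (straddles q) q) ⟩
    swapIf (straddles q) (swapIf (straddles q) q) ≡⟨ swapIf-swapIf (straddles q) _ q ⟩
    swapIf (straddles q xor straddles q) q        ≡⟨ cong (λ b → swapIf b q) (xor-same (straddles q)) ⟩
    q                                             ∎

  untwist-injective : ∀ {p q} → untwist p ≡ untwist q → p ≡ q
  untwist-injective {p} {q} e = trans (sym (untwist-involutive p)) (trans (cong untwist e) (untwist-involutive q))

  untwist-swap : ∀ q → untwist (swap q) ≡ swap (untwist q)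
  untwist-swap q = trans (cong (λ b → swapIf b (swap q)) (straddles-swap q)) (swapIf-swap (straddles q) q)

  untwist-diagonal : ∀ d → untwist (d , d) ≡ (d , d)
  untwist-diagonal d = cong (λ b → swapIf b (d , d)) (xor-same (col (init adj d)))

  untwist-reverseBoth : ∀ e q → untwist (reverseBoth e q) ≡ reverseBoth e (untwist q)
  untwist-reverseBoth e q =
    trans (cong (λ b → swapIf b (reverseBoth e q)) (straddles-reverseBoth e q)) (swapIf-reverseBoth (straddles q) e q)

  reverseBoth-xor : ∀ e e′ q → reverseBoth e (reverseBoth e′ q) ≡ reverseBoth (e xor e′) q
  reverseBoth-xor e e′ (x , y) = cong₂ _,_ (reverseIf-xor e e′ x) (reverseIf-xor e e′ y)
    where
      reverseIf-xor : ∀ e e′ d → reverseIf e (reverseIf e′ d) ≡ reverseIf (e xor e′) d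
      reverseIf-xor false e′    d = refl
      reverseIf-xor true  false d = refl
      reverseIf-xor true  true  d = reverse-involutive d

  pairAct-id : ∀ q → pairAct id id q ≡ q
  pairAct-id (x , y) = cong₂ _,_ (act-id x) (act-id y)

  pairAct-· : ∀ {g₁ g₂ h₁ h₂} → IsAut adj g₁ → IsAut adj g₂ →
              IsAut adj h₁ → IsAut adj h₂ → ∀ q →
              pairAct (g₁ · h₁) (g₂ · h₂) q ≡ pairAct g₁ g₂ (pairAct h₁ h₂ q)
  pairAct-· autg₁ autg₂ auth₁ auth₂ (x , y) = cong₂ _,_ (act-· autg₁ auth₁ x) (act-· autg₂ auth₂ y)

  pairAct-reverseBoth : ∀ {g₁ g₂} → IsAut adj g₁ → IsAut adj g₂ → ∀ e q →
                        pairAct g₁ g₂ (reverseBoth e q) ≡ reverseBoth e (pairAct g₁ g₂ q)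
  pairAct-reverseBoth aut₁ aut₂ false q       = refl
  pairAct-reverseBoth aut₁ aut₂ true  (x , y) = cong₂ _,_ (act-reverse aut₁ x) (act-reverse aut₂ y)

  pairAct-dart : ∀ {g₁ g₂ p q} → IsAut adj g₁ → IsAut adj g₂ → A2DDart adj p q →
                 A2DDart adj (pairAct g₁ g₂ p) (pairAct g₂ g₁ q)
  pairAct-dart {g₁} {p = x , _} {_ , z} aut₁ aut₂ (refl , x→z , x≢z) =
    refl ,
    trans (act-term aut₁ x) (trans (cong (g₁ ⟨$⟩ʳ_) x→z) (sym (act-init aut₁ z))) ,
    λ e → x≢z (⟨$⟩ʳ-injective g₁ (trans (sym (act-init aut₁ x)) (trans e (act-term aut₁ z))))

  wreathAct-⊙ : ∀ w w′ → InWr (IsAut adj) w → InWr (IsAut adj) w′ → ∀ q →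
                wreathAct (w ⊙ w′) q ≡ wreathAct w (wreathAct w′ q)
  wreathAct-⊙ (_ , _ , false) (_ , _ , c) (autg₁ , autg₂) (auth₁ , auth₂) q =
    pairAct-· autg₁ autg₂ auth₁ auth₂ (swapIf c q)
  wreathAct-⊙ (g₁ , g₂ , true) (h₁ , h₂ , c) (autg₁ , autg₂) (auth₁ , auth₂) q =
    trans (cong (pairAct (g₁ · h₂) (g₂ · h₁)) (sym (swapIf-swapIf true c q)))
          (pairAct-· autg₁ autg₂ auth₂ auth₁ (swap (swapIf c q)))

  wreathAct-reverseBoth : ∀ w → InWr (IsAut adj) w → ∀ e q →
                          wreathAct w (reverseBoth e q) ≡ reverseBoth e (wreathAct w q)
  wreathAct-reverseBoth (g₁ , g₂ , b) (aut₁ , aut₂) e q =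
    trans (cong (pairAct g₁ g₂) (swapIf-reverseBoth b e q)) (pairAct-reverseBoth aut₁ aut₂ e (swapIf b q))

  wreathAct-cong : ∀ w w′ → InWr (IsAut adj) w → InWr (IsAut adj) w′ → w ≈W w′ → ∀ q →
                   wreathAct w q ≡ wreathAct w′ q
  wreathAct-cong (_ , _ , b) _ (autg₁ , autg₂) (auth₁ , auth₂) (g₁≈h₁ , g₂≈h₂ , refl) q =
    cong₂ _,_ (act-cong autg₁ auth₁ g₁≈h₁ _) (act-cong autg₂ auth₂ g₂≈h₂ _)

  orientation-⊙ : ∀ w w′ → InWr (IsAut adj) w → orientation (w ⊙ w′) ≡ orientation w xor orientation w′
  orientation-⊙ (g₁ , g₂ , false) (h₁ , h₂ , c) (aut₁ , aut₂) = begin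
    c xor (swaps (g₁ · h₁) xor swaps (g₂ · h₂))
      ≡⟨ cong (c xor_) (cong₂ _xor_ (swaps-· g₁ h₁ aut₁) (swaps-· g₂ h₂ aut₂)) ⟩
    c xor ((swaps g₁ xor swaps h₁) xor (swaps g₂ xor swaps h₂))
      ≡⟨ cong (c xor_) (interchange (swaps g₁) (swaps h₁) (swaps g₂) (swaps h₂)) ⟩
    c xor ((swaps g₁ xor swaps g₂) xor (swaps h₁ xor swaps h₂))
      ≡⟨ x∙yz≈y∙xz c (swaps g₁ xor swaps g₂) (swaps h₁ xor swaps h₂) ⟩
    (swaps g₁ xor swaps g₂) xor (c xor (swaps h₁ xor swaps h₂)) ∎
  orientation-⊙ (g₁ , g₂ , true) (h₁ , h₂ , c) (aut₁ , aut₂) = begin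
    not c xor (swaps (g₁ · h₂) xor swaps (g₂ · h₁))
      ≡⟨ cong (not c xor_) (cong₂ _xor_ (swaps-· g₁ h₂ aut₁) (swaps-· g₂ h₁ aut₂)) ⟩
    not c xor ((swaps g₁ xor swaps h₂) xor (swaps g₂ xor swaps h₁))
      ≡⟨ cong (not c xor_) (interchange (swaps g₁) (swaps h₂) (swaps g₂) (swaps h₁)) ⟩
    not c xor (σg xor (swaps h₂ xor swaps h₁))
      ≡⟨ cong (λ s → not c xor (σg xor s)) (xor-comm (swaps h₂) (swaps h₁)) ⟩
    not c xor (σg xor σh)
      ≡⟨ not-distribˡ-xor c (σg xor σh) ⟨
    not (c xor (σg xor σh))
      ≡⟨ cong not (x∙yz≈y∙xz c σg σh) ⟩
    not (σg xor (c xor σh))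
      ≡⟨ not-distribˡ-xor σg (c xor σh) ⟩
    not σg xor (c xor σh) ∎
    where
      σg = swaps g₁ xor swaps g₂
      σh = swaps h₁ xor swaps h₂

  orientation-cong : ∀ w w′ → w ≈W w′ → orientation w ≡ orientation w′
  orientation-cong (g₁ , g₂ , b) (h₁ , h₂ , _) (g₁≈h₁ , g₂≈h₂ , refl) =
    cong₂ (λ s₁ s₂ → b xor (s₁ xor s₂))
          (swaps-cong {g₁} {h₁} g₁≈h₁) (swaps-cong {g₂} {h₂} g₂≈h₂)

  orientation-one : orientation (wr-one {n}) ≡ false
  orientation-one = xor-same (swaps id)

  orientation-wr-inv : ∀ w → InWr (IsAut adj) w → orientation (wr-inv w) ≡ orientation w
  orientation-wr-inv (g₁ , g₂ , false) (aut₁ , aut₂) =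
    cong₂ _xor_ (swaps-flip g₁ aut₁) (swaps-flip g₂ aut₂)
  orientation-wr-inv (g₁ , g₂ , true)  (aut₁ , aut₂) =
    cong (true xor_) (trans (cong₂ _xor_ (swaps-flip g₂ aut₂) (swaps-flip g₁ aut₁))
                            (xor-comm (swaps g₂) (swaps g₁)))

  orientation-false⇒bit : ∀ w → orientation w ≡ false → proj₂ (proj₂ w) ≡ partSwap w
  orientation-false⇒bit w@(_ , _ , b) preserving =
    trans (sym (xor-xor-cancelʳ b (partSwap w))) (cong (_xor partSwap w) preserving)

  a2dAct-⊙ : ∀ w w′ → InWr (IsAut adj) w → InWr (IsAut adj) w′ → ∀ q →
             a2dAct (w ⊙ w′) q ≡ a2dAct w (a2dAct w′ q)
  a2dAct-⊙ w w′ aw aw′ q = begin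
    untwist (wreathAct (w ⊙ w′) (untwist (reverseBoth (orientation (w ⊙ w′)) q)))
      ≡⟨ cong (λ e → untwist (wreathAct (w ⊙ w′) (untwist (reverseBoth e q)))) (orientation-⊙ w w′ aw) ⟩
    untwist (wreathAct (w ⊙ w′) (untwist (reverseBoth (e xor e′) q)))
      ≡⟨ cong untwist (wreathAct-⊙ w w′ aw aw′ _) ⟩
    untwist (wreathAct w (wreathAct w′ (untwist (reverseBoth (e xor e′) q))))
      ≡⟨ cong (λ r → untwist (wreathAct w (wreathAct w′ (untwist r)))) (reverseBoth-xor e e′ q) ⟨
    untwist (wreathAct w (wreathAct w′ (untwist (reverseBoth e (reverseBoth e′ q)))))
      ≡⟨ cong (λ r → untwist (wreathAct w (wreathAct w′ r))) (untwist-reverseBoth e _) ⟩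
    untwist (wreathAct w (wreathAct w′ (reverseBoth e (untwist (reverseBoth e′ q)))))
      ≡⟨ cong (λ r → untwist (wreathAct w r)) (wreathAct-reverseBoth w′ aw′ e _) ⟩
    untwist (wreathAct w (reverseBoth e r′))
      ≡⟨ cong (λ r → untwist (wreathAct w r)) (untwist-involutive _) ⟨
    untwist (wreathAct w (untwist (untwist (reverseBoth e r′))))
      ≡⟨ cong (λ r → untwist (wreathAct w (untwist r))) (untwist-reverseBoth e r′) ⟩
    untwist (wreathAct w (untwist (reverseBoth e (untwist r′)))) ∎
    where
      e  = orientation w
      e′ = orientation w′
      r′ = wreathAct w′ (untwist (reverseBoth e′ q))

  a2dAct-cong : ∀ w w′ → InWr (IsAut adj) w → InWr (IsAut adj) w′ → w ≈W w′ → ∀ q →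
                a2dAct w q ≡ a2dAct w′ q
  a2dAct-cong w w′ aw aw′ w≈w′ q =
    trans (cong (λ e → untwist (wreathAct w (untwist (reverseBoth e q)))) (orientation-cong w w′ w≈w′))
          (cong untwist (wreathAct-cong w w′ aw aw′ w≈w′ _))

  a2dAct-one : ∀ q → a2dAct wr-one q ≡ q
  a2dAct-one q = begin
    untwist (pairAct id id (untwist (reverseBoth (orientation wr-one) q)))
      ≡⟨ cong (λ e → untwist (pairAct id id (untwist (reverseBoth e q)))) orientation-one ⟩
    untwist (pairAct id id (untwist q)) ≡⟨ cong untwist (pairAct-id _) ⟩
    untwist (untwist q)                 ≡⟨ untwist-involutive q ⟩
    q                                   ∎

  InWr-aut-⊙ : ∀ w w′ → InWr (IsAut adj) w → InWr (IsAut adj) w′ → InWr (IsAut adj) (w ⊙ w′)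
  InWr-aut-⊙ = InWr-⊙ (λ {g} {h} → isAut-· {g} {h})

  InWr-aut-inv : ∀ w → InWr (IsAut adj) w → InWr (IsAut adj) (wr-inv w)
  InWr-aut-inv = InWr-inv (λ {g} → isAut-flip {g})

  a2dAct-inverseʳ : ∀ w → InWr (IsAut adj) w → ∀ q → a2dAct w (a2dAct (wr-inv w) q) ≡ q
  a2dAct-inverseʳ w aw q = begin
    a2dAct w (a2dAct (wr-inv w) q) ≡⟨ a2dAct-⊙ w (wr-inv w) aw aw⁻¹ q ⟨
    a2dAct (w ⊙ wr-inv w) q        ≡⟨ a2dAct-cong _ wr-one (InWr-aut-⊙ w (wr-inv w) aw aw⁻¹)
                                                        (isAut-id , isAut-id) (⊙-inverseʳ w) q ⟩
    a2dAct wr-one q                ≡⟨ a2dAct-one q ⟩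
    q                              ∎
    where aw⁻¹ = InWr-aut-inv w aw

  a2dAct-inverseˡ : ∀ w → InWr (IsAut adj) w → ∀ q → a2dAct (wr-inv w) (a2dAct w q) ≡ q
  a2dAct-inverseˡ w aw q = begin
    a2dAct (wr-inv w) (a2dAct w q) ≡⟨ a2dAct-⊙ (wr-inv w) w aw⁻¹ aw q ⟨
    a2dAct (wr-inv w ⊙ w) q        ≡⟨ a2dAct-cong _ wr-one (InWr-aut-⊙ (wr-inv w) w aw⁻¹ aw)
                                                        (isAut-id , isAut-id) (⊙-inverseˡ w) q ⟩
    a2dAct wr-one q                ≡⟨ a2dAct-one q ⟩
    q                              ∎
    where aw⁻¹ = InWr-aut-inv w aw

  dartAvoiding : Fin n → Fin n → Dart adj
  dartAvoiding v u = (v , proj₁ (avoid v u)) , proj₁ (proj₂ (avoid v u))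

  dartAvoiding-term : ∀ v u → term adj (dartAvoiding v u) ≢ u
  dartAvoiding-term v u = proj₂ (proj₂ (avoid v u))

  private
    fork₁ fork₂ : Dart adj
    fork₁ = dartAvoiding v₀ v₀
    fork₂ = dartAvoiding v₀ (term adj fork₁)

  act-faithful : ∀ g h → IsAut adj g → IsAut adj h → (∀ d → act g d ≡ act h d) → g ≈ h
  act-faithful g h aut-g aut-h same v =
    trans (sym (act-init aut-g d)) (trans (cong (init adj) (same d)) (act-init aut-h d))
    where d = dartAvoiding v v

  act-≢-act∘reverse : ∀ g h → IsAut adj g → IsAut adj h → ¬ (∀ d → act g d ≡ act h (reverse d))
  act-≢-act∘reverse g h aut-g aut-h same =
    dartAvoiding-term v₀ (term adj fork₁)
      (sym (⟨$⟩ʳ-injective h (trans (sym (lands fork₁)) (lands fork₂))))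
    where
      lands : ∀ d → g ⟨$⟩ʳ init adj d ≡ h ⟨$⟩ʳ term adj d
      lands d = trans (sym (act-init aut-g d))
                      (trans (cong (init adj) (same d)) (act-init aut-h (reverse d)))

  wreathAct-faithful : ∀ w w′ → InWr (IsAut adj) w → InWr (IsAut adj) w′ →
                       (∀ q → wreathAct w q ≡ wreathAct w′ q) → w ≈W w′
  wreathAct-faithful (g₁ , g₂ , b) (h₁ , h₂ , c) (autg₁ , autg₂) (auth₁ , auth₂) same =
    g₁≈h₁ , act-faithful g₂ h₂ autg₂ auth₂ (λ d → cong proj₂ (diagonal d)) ,
    bit b c (same (fork₁ , fork₂))
    where
      diagonal : ∀ d → pairAct g₁ g₂ (d , d) ≡ pairAct h₁ h₂ (d , d)
      diagonal d = trans (cong (pairAct g₁ g₂) (sym (swapIf-diagonal b d)))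
                         (trans (same (d , d)) (cong (pairAct h₁ h₂) (swapIf-diagonal c d)))
      g₁≈h₁ = act-faithful g₁ h₁ autg₁ auth₁ (λ d → cong proj₁ (diagonal d))
      separates : ∀ {d d′} → act g₁ d ≡ act h₁ d′ → term adj d ≡ term adj d′
      separates {d} {d′} e = ⟨$⟩ʳ-injective g₁
        (trans (sym (act-term autg₁ d))
               (trans (cong (term adj) e) (trans (act-term auth₁ d′) (sym (g₁≈h₁ _)))))
      bit : ∀ k k′ → pairAct g₁ g₂ (swapIf k (fork₁ , fork₂)) ≡
                     pairAct h₁ h₂ (swapIf k′ (fork₁ , fork₂)) → k ≡ k′
      bit false false _ = refl
      bit true  true  _ = refl
      bit false true  e = ⊥-elim (dartAvoiding-term v₀ _ (sym (separates (cong proj₁ e))))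
      bit true  false e = ⊥-elim (dartAvoiding-term v₀ _ (separates (cong proj₁ e)))

  a2dAct-orientation : ∀ w w′ → InWr (IsAut adj) w → InWr (IsAut adj) w′ →
                       (∀ q → a2dAct w q ≡ a2dAct w′ q) → orientation w ≡ orientation w′
  a2dAct-orientation w@(g₁ , g₂ , b) w′@(h₁ , h₂ , c) (autg₁ , _) (auth₁ , _) same =
    from-diagonal (orientation w) (orientation w′)
      (λ d → cong proj₁ (untwist-injective
                           (trans (sym (diagonal w d)) (trans (same (d , d)) (diagonal w′ d)))))
    where
      diagonal : ∀ v d → let r = reverseIf (orientation v) d in
                 a2dAct v (d , d) ≡ untwist (pairAct (proj₁ v) (proj₁ (proj₂ v)) (r , r))
      diagonal v@(_ , _ , k) d = cong (λ r → untwist (pairAct _ _ r))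
        (trans (cong (swapIf k) (untwist-diagonal (reverseIf (orientation v) d))) (swapIf-diagonal k _))
      from-diagonal : ∀ e e′ → (∀ d → act g₁ (reverseIf e d) ≡ act h₁ (reverseIf e′ d)) → e ≡ e′
      from-diagonal false false _    = refl
      from-diagonal true  true  _    = refl
      from-diagonal false true  same = ⊥-elim (act-≢-act∘reverse g₁ h₁ autg₁ auth₁ same)
      from-diagonal true  false same =
        ⊥-elim (act-≢-act∘reverse h₁ g₁ auth₁ autg₁ (λ d → sym (same d)))

  a2dAct-faithful : ∀ w w′ → InWr (IsAut adj) w → InWr (IsAut adj) w′ →
                    (∀ q → a2dAct w q ≡ a2dAct w′ q) → w ≈W w′
  a2dAct-faithful w w′ aw aw′ same = wreathAct-faithful w w′ aw aw′ λ r → untwist-injective (begin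
    untwist (wreathAct w r)                              ≡⟨ undo w r ⟨
    a2dAct w (reverseBoth (orientation w) (untwist r))   ≡⟨ same _ ⟩
    a2dAct w′ (reverseBoth (orientation w) (untwist r))  ≡⟨ cong (λ e → a2dAct w′ (reverseBoth e (untwist r)))
                                                                 (a2dAct-orientation w w′ aw aw′ same) ⟩
    a2dAct w′ (reverseBoth (orientation w′) (untwist r)) ≡⟨ undo w′ r ⟩
    untwist (wreathAct w′ r)                             ∎)
    where
      undo : ∀ v r → a2dAct v (reverseBoth (orientation v) (untwist r)) ≡ untwist (wreathAct v r)
      undo v r = cong (λ s → untwist (wreathAct v s)) (trans (cong untwist (trans
        (reverseBoth-xor (orientation v) _ (untwist r))
        (cong (λ e → reverseBoth e (untwist r)) (xor-same (orientation v))))) (untwist-involutive r))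

  -- twisted true g₁ g₂ is, definitionally, pairAct g₂ g₁.
  twisted : Bool → Permutation′ n → Permutation′ n → A2DVertex adj → A2DVertex adj
  twisted k g₁ g₂ q = swapIf k (pairAct g₁ g₂ (swapIf k q))

  twisted-dart : ∀ k g₁ g₂ {p q} → IsAut adj g₁ → IsAut adj g₂ → A2DDart adj p q →
                 A2DDart adj (twisted k g₁ g₂ p) (twisted (not k) g₁ g₂ q)
  twisted-dart false g₁ g₂ aut₁ aut₂ d = pairAct-dart aut₁ aut₂ d
  twisted-dart true  g₁ g₂ aut₁ aut₂ d = pairAct-dart aut₂ aut₁ d

  a2dAct-twisted : ∀ w → InWr (IsAut adj) w → orientation w ≡ false → ∀ q →
                   a2dAct w q ≡ twisted (straddles q xor partSwap w) (proj₁ w) (proj₁ (proj₂ w)) q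
  a2dAct-twisted w@(g₁ , g₂ , b) (aut₁ , aut₂) preserving q = begin
    untwist (pairAct g₁ g₂ (swapIf b (untwist (reverseBoth (orientation w) q))))
      ≡⟨ cong (λ e → untwist (pairAct g₁ g₂ (swapIf b (untwist (reverseBoth e q))))) preserving ⟩
    untwist (pairAct g₁ g₂ (swapIf b (untwist q)))
      ≡⟨ cong (λ r → untwist (pairAct g₁ g₂ r)) inner ⟩
    untwist (pairAct g₁ g₂ (swapIf k q))
      ≡⟨ cong (λ c → swapIf c (pairAct g₁ g₂ (swapIf k q))) outer ⟩
    twisted k g₁ g₂ q ∎
    where
      k = straddles q xor partSwap w
      inner : swapIf b (untwist q) ≡ swapIf k q
      inner = trans (swapIf-swapIf b (straddles q) q) (cong (λ c → swapIf c q)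
                (trans (xor-comm b (straddles q)) (cong (straddles q xor_) (orientation-false⇒bit w preserving))))
      outer : straddles (pairAct g₁ g₂ (swapIf k q)) ≡ k
      outer = trans (straddles-pairAct {g₁} {g₂} aut₁ aut₂ (swapIf k q))
                    (cong (_xor partSwap w) (straddles-swapIf k q))

  a2dAct-on-dart : ∀ w → InWr (IsAut adj) w → orientation w ≡ false → ∀ p q → A2DDart adj p q →
                   ∀ {k} → straddles p xor partSwap w ≡ k →
                   a2dAct w p ≡ twisted k (proj₁ w) (proj₁ (proj₂ w)) p ×
                   a2dAct w q ≡ twisted (not k) (proj₁ w) (proj₁ (proj₂ w)) q
  a2dAct-on-dart w aw preserving p q d refl =
    a2dAct-twisted w aw preserving p ,
    trans (a2dAct-twisted w aw preserving q) (cong (λ k → twisted k (proj₁ w) (proj₁ (proj₂ w)) q)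
      (trans (cong (_xor partSwap w) (straddles-dart {p} {q} d))
             (sym (not-distribˡ-xor (straddles p) (partSwap w)))))

  a2dAct-preserves : ∀ w → InWr (IsAut adj) w → orientation w ≡ false → ∀ p q →
                     A2DDart adj p q → A2DDart adj (a2dAct w p) (a2dAct w q)
  a2dAct-preserves w@(g₁ , g₂ , _) aw@(aut₁ , aut₂) preserving p q d =
    subst₂ (A2DDart adj) (sym (proj₁ on)) (sym (proj₂ on)) (twisted-dart k g₁ g₂ {p} {q} aut₁ aut₂ d)
    where
      k = straddles p xor partSwap w
      on = a2dAct-on-dart w aw preserving p q d {k} refl

  reverseDarts : A2DVertex adj → A2DVertex adj
  reverseDarts q = swap (reverseBoth true q)

  reverseDarts-dart : ∀ p q → A2DDart adj p q → A2DDart adj (reverseDarts q) (reverseDarts p)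
  reverseDarts-dart (x , y) (.y , z) (refl , x→z , x≢z) = refl , sym x→z , λ e → x≢z (sym e)

  flipBit : WrEl {n} → WrEl {n}
  flipBit (g₁ , g₂ , b) = g₁ , g₂ , not b

  orientation-flipBit : ∀ w → orientation w ≡ true → orientation (flipBit w) ≡ false
  orientation-flipBit w@(_ , _ , b) reversing =
    trans (sym (not-distribˡ-xor b (partSwap w))) (cong not reversing)

  a2dAct-reversing : ∀ w → orientation w ≡ true → ∀ q → a2dAct w q ≡ a2dAct (flipBit w) (reverseDarts q)
  a2dAct-reversing w reversing q = begin
    untwist (wreathAct w (untwist (reverseBoth (orientation w) q)))
      ≡⟨ cong (λ e → untwist (wreathAct w (untwist (reverseBoth e q)))) reversing ⟩
    untwist (wreathAct w (untwist (reverseBoth true q)))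
      ≡⟨ cong untwist (wreathAct-flipBit w _) ⟨
    untwist (wreathAct (flipBit w) (swap (untwist (reverseBoth true q))))
      ≡⟨ cong (λ r → untwist (wreathAct (flipBit w) r)) (untwist-swap _) ⟨
    untwist (wreathAct (flipBit w) (untwist (reverseDarts q)))
      ≡⟨ cong (λ e → untwist (wreathAct (flipBit w) (untwist (reverseBoth e (reverseDarts q)))))
              (orientation-flipBit w reversing) ⟨
    a2dAct (flipBit w) (reverseDarts q) ∎
    where
      wreathAct-flipBit : ∀ v r → wreathAct (flipBit v) (swap r) ≡ wreathAct v r
      wreathAct-flipBit (_ , _ , false) r = refl
      wreathAct-flipBit (_ , _ , true)  r = refl

  a2dAct-reverses : ∀ w → InWr (IsAut adj) w → orientation w ≡ true → ∀ p q →
                    A2DDart adj p q → A2DDart adj (a2dAct w q) (a2dAct w p)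
  a2dAct-reverses w aw reversing p q d =
    subst₂ (A2DDart adj) (sym (a2dAct-reversing w reversing q)) (sym (a2dAct-reversing w reversing p))
      (a2dAct-preserves (flipBit w) aw (orientation-flipBit w reversing) _ _ (reverseDarts-dart p q d))

  a2gAct-preserves : ∀ w → InWr (IsAut adj) w → ∀ p q →
                     A2GDart adj p q → A2GDart adj (a2dAct w p) (a2dAct w q)
  a2gAct-preserves w aw p q = by-orientation (orientation w) refl
    where
      by-orientation : ∀ e → orientation w ≡ e → A2GDart adj p q → A2GDart adj (a2dAct w p) (a2dAct w q)
      by-orientation false eq (inj₁ p→q) = inj₁ (a2dAct-preserves w aw eq p q p→q)
      by-orientation false eq (inj₂ q→p) = inj₂ (a2dAct-preserves w aw eq q p q→p)
      by-orientation true  eq (inj₁ p→q) = inj₂ (a2dAct-reverses w aw eq p q p→q)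
      by-orientation true  eq (inj₂ q→p) = inj₁ (a2dAct-reverses w aw eq q p q→p)

  arrange : Bool → Permutation′ n → Permutation′ n → WrEl {n}
  arrange false g h = g , h , swaps g xor swaps h
  arrange true  g h = h , g , swaps h xor swaps g

  orientation-arrange : ∀ k g h → orientation (arrange k g h) ≡ false
  orientation-arrange false g h = xor-same (swaps g xor swaps h)
  orientation-arrange true  g h = xor-same (swaps h xor swaps g)

  InWr-arrange : ∀ {P : Perm {n} → Set} k {g h} → P g → P h → InWr P (arrange k g h)
  InWr-arrange false pg ph = pg , ph
  InWr-arrange true  pg ph = ph , pg

  a2dAct-arrange : ∀ g h → IsAut adj g → IsAut adj h → ∀ p q → A2DDart adj p q →
                   let w = arrange (straddles (pairAct g h p)) g h in
                   a2dAct w p ≡ pairAct g h p × a2dAct w q ≡ pairAct h g q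
  a2dAct-arrange g h aut-g aut-h p q d with straddles (pairAct g h p) in eq
  ... | false = a2dAct-on-dart (arrange false g h) (aut-g , aut-h) (orientation-arrange false g h) p q d
                  (trans (sym (straddles-pairAct {g} {h} aut-g aut-h p)) eq)
  ... | true  = a2dAct-on-dart (arrange true g h) (aut-h , aut-g) (orientation-arrange true g h) p q d
                  (trans (cong (straddles p xor_) (xor-comm (swaps h) (swaps g)))
                         (trans (sym (straddles-pairAct {g} {h} aut-g aut-h p)) eq))

  isAutPair? : ∀ w → Dec (InWr (IsAut adj) w)
  isAutPair? (g₁ , g₂ , _) = isAut? g₁ ×-dec isAut? g₂

  autPart : WrEl {n} → WrEl {n}
  autPart w with isAutPair? w
  ... | yes _ = w
  ... | no  _ = wr-one

  autPart-aut : ∀ w → InWr (IsAut adj) (autPart w)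
  autPart-aut w with isAutPair? w
  ... | yes aw = aw
  ... | no  _  = isAut-id , isAut-id

  autPart-≡ : ∀ w → InWr (IsAut adj) w → autPart w ≡ w
  autPart-≡ w aw with isAutPair? w
  ... | yes _   = refl
  ... | no  ¬aw = ⊥-elim (¬aw aw)

  -- Elements of G ≀ C₂ whose coordinates are not automorphisms are sent to the identity.
  ρ : WrEl {n} → A2DVertex adj ↔ A2DVertex adj
  ρ w = mk↔ₛ′ (a2dAct (autPart w)) (a2dAct (wr-inv (autPart w)))
              (a2dAct-inverseʳ (autPart w) (autPart-aut w)) (a2dAct-inverseˡ (autPart w) (autPart-aut w))

  ρ-to : ∀ w → InWr (IsAut adj) w → ∀ q → Inverse.to (ρ w) q ≡ a2dAct w q
  ρ-to w aw q = cong (λ v → a2dAct v q) (autPart-≡ w aw)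

  admitsDartTransitive : {R : A2DVertex adj → A2DVertex adj → Set} {K : WrEl {n} → Set} →
    (∀ {w} → K w → InWr (IsAut adj) w) → (∀ {w} → K w → K (wr-inv w)) →
    (∀ {w} → K w → ∀ p q → R p q → R (a2dAct w p) (a2dAct w q)) →
    (∀ p q p′ q′ → R p q → R p′ q′ → ∃[ w ] (K w × a2dAct w p ≡ p′ × a2dAct w q ≡ q′)) →
    AdmitsDartTransitive (A2DVertex adj) R K
  admitsDartTransitive {R} {K} K-aut K-inv preserves transitive = record
    { ρ        = ρ
    ; hom      = λ {w} {w′} kw kw′ → hom w w′ (K-aut kw) (K-aut kw′)
    ; faithful = λ {w} {w′} kw kw′ same → a2dAct-faithful w w′ (K-aut kw) (K-aut kw′)
                   (λ q → trans (sym (ρ-to w (K-aut kw) q)) (trans (same q) (ρ-to w′ (K-aut kw′) q)))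
    ; symm     = λ {w} kw p q → forward kw p q , backward kw p q
    ; trans    = λ p q p′ q′ d d′ → realise (transitive p q p′ q′ d d′)
    }
    where
      to = Inverse.to

      hom : ∀ w w′ → InWr (IsAut adj) w → InWr (IsAut adj) w′ → ∀ q →
            to (ρ (w ⊙ w′)) q ≡ to (ρ w) (to (ρ w′) q)
      hom w w′ aw aw′ q = begin
        to (ρ (w ⊙ w′)) q        ≡⟨ ρ-to (w ⊙ w′) (InWr-aut-⊙ w w′ aw aw′) q ⟩
        a2dAct (w ⊙ w′) q        ≡⟨ a2dAct-⊙ w w′ aw aw′ q ⟩
        a2dAct w (a2dAct w′ q)   ≡⟨ cong (a2dAct w) (ρ-to w′ aw′ q) ⟨
        a2dAct w (to (ρ w′) q)   ≡⟨ ρ-to w aw _ ⟨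
        to (ρ w) (to (ρ w′) q)   ∎

      forward : ∀ {w} → K w → ∀ p q → R p q → R (to (ρ w) p) (to (ρ w) q)
      forward {w} kw p q d =
        subst₂ R (sym (ρ-to w (K-aut kw) p)) (sym (ρ-to w (K-aut kw) q)) (preserves kw p q d)

      backward : ∀ {w} → K w → ∀ p q → R (to (ρ w) p) (to (ρ w) q) → R p q
      backward {w} kw p q d = subst₂ R (a2dAct-inverseˡ w (K-aut kw) p) (a2dAct-inverseˡ w (K-aut kw) q)
        (preserves (K-inv kw) _ _ (subst₂ R (ρ-to w (K-aut kw) p) (ρ-to w (K-aut kw) q) d))

      realise : ∀ {p q p′ q′} → ∃[ w ] (K w × a2dAct w p ≡ p′ × a2dAct w q ≡ q′) →
                ∃[ w ] (K w × to (ρ w) p ≡ p′ × to (ρ w) q ≡ q′)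
      realise {p} {q} (w , kw , e , e′) =
        w , kw , trans (ρ-to w (K-aut kw) p) e , trans (ρ-to w (K-aut kw) q) e′

module TwoDartTransitiveGroup {n : ℕ} (adj : Fin n → Fin n → Bool) (adj-sym : ∀ u v → adj u v ≡ adj v u)
                              (connected : Connected adj) (col : Fin n → Bool)
                              (bipartition : ProperBipartition adj col) (v₀ : Fin n)
                              (avoid : ∀ v u → ∃[ w ] (T (adj v w) × w ≢ u))
                              (G : Perm {n} → Set) (subgroup : IsAutSubgroup adj G)
                              (transitive : TwoDartTransitive adj G) where

  open Darts adj
  open Parity adj connected col bipartition v₀
  open A2DAction adj adj-sym connected col bipartition v₀ avoid
  open IsAutSubgroup subgroup
    renaming (resp to G-resp; has-id to G-id; closed to G-∘ₚ; inv to G-flip; auts to G-aut)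

  G-· : ∀ {g h} → G g → G h → G (g · h)
  G-· Gg Gh = G-∘ₚ Gh Gg

  InWr-G⇒aut : ∀ w → InWr G w → InWr (IsAut adj) w
  InWr-G⇒aut _ = map G-aut G-aut

  extension : Dart adj → Dart adj
  extension y = dartAvoiding (term adj y) (init adj y)

  extension-twoDart : ∀ y → TwoDart adj y (extension y)
  extension-twoDart y = refl , λ e → dartAvoiding-term (term adj y) (init adj y) (sym e)

  a2d-transitive : ∀ p q p′ q′ → A2DDart adj p q → A2DDart adj p′ q′ →
                   ∃[ w ] (InWr G w × orientation w ≡ false × a2dAct w p ≡ p′ × a2dAct w q ≡ q′)
  a2d-transitive (x , y) (.y , z) (x′ , y′) (.y′ , z′) (refl , xz) (refl , x′z′)
    with transitive x z x′ z′ xz x′z′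
       | transitive y (extension y) y′ (extension y′) (extension-twoDart y) (extension-twoDart y′)
  ... | g , Gg , gx₀ , gx₁ , gz₁ | h , Gh , hy₀ , hy₁ , _ =
    arrange k g h , InWr-arrange {G} k Gg Gh , orientation-arrange k g h ,
    trans (proj₁ arranged) (cong₂ _,_ gx hy) , trans (proj₂ arranged) (cong₂ _,_ hy gz)
    where
      k = straddles (pairAct g h (x , y))
      arranged = a2dAct-arrange g h (G-aut Gg) (G-aut Gh) (x , y) (y , z) (refl , xz)
      gx = act-≡ (G-aut Gg) gx₀ gx₁
      hy = act-≡ (G-aut Gh) hy₀ hy₁
      gz = act-≡ (G-aut Gg) (trans (cong (g ⟨$⟩ʳ_) (sym (proj₁ xz))) (trans gx₁ (proj₁ x′z′))) gz₁

  wr-t : WrEl {n}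
  wr-t = id , id , true

  private
    wr-t-reverses : ∀ p q → A2DDart adj p q → A2DDart adj (a2dAct wr-t q) (a2dAct wr-t p)
    wr-t-reverses =
      a2dAct-reverses wr-t (isAut-id , isAut-id) (cong (true xor_) (xor-same (swaps id)))

    via-wr-t : ∀ p q p′ q′ → A2DDart adj (a2dAct wr-t p) (a2dAct wr-t q) → A2DDart adj p′ q′ →
               ∃[ w ] (InWr G w × a2dAct w p ≡ p′ × a2dAct w q ≡ q′)
    via-wr-t p q p′ q′ d d′ = compose (a2d-transitive _ _ p′ q′ d d′)
      where
        compose : ∀ {p″ q″} → ∃[ w ] (InWr G w × orientation w ≡ false ×
                    a2dAct w (a2dAct wr-t p) ≡ p″ × a2dAct w (a2dAct wr-t q) ≡ q″) →
                  ∃[ w ] (InWr G w × a2dAct w p ≡ p″ × a2dAct w q ≡ q″)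
        compose (w , Gw , _ , e , e′) =
          w ⊙ wr-t , InWr-⊙ {P = G} G-· w wr-t Gw (G-id , G-id) ,
          trans (a2dAct-⊙ w wr-t (InWr-G⇒aut w Gw) (isAut-id , isAut-id) p) e ,
          trans (a2dAct-⊙ w wr-t (InWr-G⇒aut w Gw) (isAut-id , isAut-id) q) e′

    swapEqs : ∀ {p q p′ q′} → ∃[ w ] (InWr G w × a2dAct w q ≡ q′ × a2dAct w p ≡ p′) →
              ∃[ w ] (InWr G w × a2dAct w p ≡ p′ × a2dAct w q ≡ q′)
    swapEqs (w , Gw , e , e′) = w , Gw , e′ , e

  a2g-transitive : ∀ p q p′ q′ → A2GDart adj p q → A2GDart adj p′ q′ →
                   ∃[ w ] (InWr G w × a2dAct w p ≡ p′ × a2dAct w q ≡ q′)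
  a2g-transitive p q p′ q′ (inj₁ d) (inj₁ d′) with a2d-transitive p q p′ q′ d d′
  ... | w , Gw , _ , e = w , Gw , e
  a2g-transitive p q p′ q′ (inj₂ d) (inj₂ d′) with a2d-transitive q p q′ p′ d d′
  ... | w , Gw , _ , e = swapEqs (w , Gw , e)
  a2g-transitive p q p′ q′ (inj₁ d) (inj₂ d′) =
    swapEqs (via-wr-t q p q′ p′ (wr-t-reverses p q d) d′)
  a2g-transitive p q p′ q′ (inj₂ d) (inj₁ d′) = via-wr-t p q p′ q′ (wr-t-reverses q p d) d′

  a2gAdmits : AdmitsDartTransitive (A2DVertex adj) (A2GDart adj) (InWr G)
  a2gAdmits = admitsDartTransitive (λ {w} → InWr-G⇒aut w) (λ {w} → InWr-inv {P = G} G-flip w)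
                (λ {w} Gw → a2gAct-preserves w (InWr-G⇒aut w Gw)) a2g-transitive

  module _ (α : Perm {n}) (Gα : G α) (α∉H : ¬ (G α × (∀ v → col (α ⟨$⟩ʳ v) ≡ col v))) where

    H : Perm {n} → Set
    H g = G g × (∀ v → col (g ⟨$⟩ʳ v) ≡ col v)

    H⇒swaps-false : ∀ {g} → H g → swaps g ≡ false
    H⇒swaps-false (_ , preserves) = trans (cong (_xor col v₀) (preserves v₀)) (xor-same (col v₀))

    swaps-false⇒H : ∀ g → G g → swaps g ≡ false → H g
    swaps-false⇒H g Gg e = Gg , λ v → trans (col-act g (G-aut Gg) v) (cong (_xor col v) e)

    swaps-α : swaps α ≡ true
    swaps-α = ¬-not (λ e → α∉H (swaps-false⇒H α Gα e))

    InA-sound : ∀ {w} → InA H α w → InWr G w × orientation w ≡ false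
    InA-sound (genHH Hh₁ Hh₂) =
      (proj₁ Hh₁ , proj₁ Hh₂) , cong₂ _xor_ (H⇒swaps-false Hh₁) (H⇒swaps-false Hh₂)
    InA-sound genαα  = (Gα , Gα) , xor-same (swaps α)
    InA-sound gen1αt = (G-id , Gα) , cong (true xor_) (cong₂ _xor_ swaps-id swaps-α)
    InA-sound one    = (G-id , G-id) , orientation-one
    InA-sound (mul {x} {y} x∈A y∈A) with InA-sound x∈A | InA-sound y∈A
    ... | Gx , ex | Gy , ey =
      InWr-⊙ {P = G} G-· x y Gx Gy , trans (orientation-⊙ x y (InWr-G⇒aut x Gx)) (cong₂ _xor_ ex ey)
    InA-sound (inv {x} x∈A) with InA-sound x∈A
    ... | Gx , ex = InWr-inv {P = G} G-flip x Gx , trans (orientation-wr-inv x (InWr-G⇒aut x Gx)) ex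
    InA-sound (resp {x} {y} x≈y x∈A) with InA-sound x∈A
    ... | Gx , ex = InWr-resp {P = G} G-resp x y x≈y Gx , trans (sym (orientation-cong x y x≈y)) ex

    -- A representative of the coset of H × H in A whose coordinates swap the parts as s₁ , s₂ say.
    representative : ∀ s₁ s₂ → ∃[ c₁ ] ∃[ c₂ ]
                     (InA H α (c₁ , c₂ , s₁ xor s₂) × G c₁ × G c₂ × swaps c₁ ≡ s₁ × swaps c₂ ≡ s₂)
    representative false false = id , id , one , G-id , G-id , swaps-id , swaps-id
    representative true  true  = α , α , genαα , Gα , Gα , swaps-α , swaps-α
    representative false true  = id , α , gen1αt , G-id , Gα , swaps-id , swaps-α
    representative true  false = flip α , flip id , inv gen1αt , G-flip Gα , G-flip G-id ,
                                 trans (swaps-flip α (G-aut Gα)) swaps-α ,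
                                 trans (swaps-flip id isAut-id) swaps-id

    InA-complete : ∀ w → InWr G w → orientation w ≡ false → InA H α w
    InA-complete w@(g₁ , g₂ , b) (G₁ , G₂) preserving with representative (swaps g₁) (swaps g₂)
    ... | c₁ , c₂ , c∈A , Gc₁ , Gc₂ , sc₁ , sc₂ =
      resp (cancel g₁ c₁ , cancel g₂ c₂ , sym (orientation-false⇒bit w preserving))
           (mul (genHH (coset g₁ c₁ G₁ Gc₁ sc₁) (coset g₂ c₂ G₂ Gc₂ sc₂)) c∈A)
      where
        cancel : ∀ g c → ((g · flip c) · c) ≈ g
        cancel g c _ = cong (g ⟨$⟩ʳ_) (inverseˡ c)
        coset : ∀ g c → G g → G c → swaps c ≡ swaps g → H (g · flip c)
        coset g c Gg Gc sc = swaps-false⇒H (g · flip c) (G-· Gg (G-flip Gc)) (begin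
          swaps (g · flip c)          ≡⟨ swaps-· g (flip c) (G-aut Gg) ⟩
          swaps g xor swaps (flip c)  ≡⟨ cong (swaps g xor_) (trans (swaps-flip c (G-aut Gc)) sc) ⟩
          swaps g xor swaps g         ≡⟨ xor-same (swaps g) ⟩
          false                       ∎)

    a2dAdmits : AdmitsDartTransitive (A2DVertex adj) (A2DDart adj) (InA H α)
    a2dAdmits = admitsDartTransitive (λ {w} w∈A → InWr-G⇒aut w (proj₁ (InA-sound w∈A))) inv
      (λ {w} w∈A → a2dAct-preserves w (InWr-G⇒aut w (proj₁ (InA-sound w∈A))) (proj₂ (InA-sound w∈A)))
      realise
      where
        realise : ∀ p q p′ q′ → A2DDart adj p q → A2DDart adj p′ q′ →
                  ∃[ w ] (InA H α w × a2dAct w p ≡ p′ × a2dAct w q ≡ q′)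
        realise p q p′ q′ d d′ with a2d-transitive p q p′ q′ d d′
        ... | w , Gw , preserving , e = w , InA-complete w Gw preserving , e

theorem4p1 : (n : ℕ) (adj : Fin n → Fin n → Bool) →
    1 ≤ n → IsGraph adj → Connected adj → Cubic adj →
    (col : Fin n → Bool) → ProperBipartition adj col →
    (G : Permutation′ n → Set) → IsAutSubgroup adj G → TwoDartTransitive adj G →
    (α : Permutation′ n) → G α →
    ¬ (G α × (∀ v → col (α ⟨$⟩ʳ v) ≡ col v)) →
    AdmitsDartTransitive (A2DVertex adj) (A2DDart adj)
      (InA (λ g → G g × (∀ v → col (g ⟨$⟩ʳ v) ≡ col v)) α)
    × AdmitsDartTransitive (A2DVertex adj) (A2GDart adj) (InWr G)
theorem4p1 n adj 1≤n (adj-sym , _) connected cubic col bipartition G subgroup transitive α Gα α∉H =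
  a2dAdmits α Gα α∉H , a2gAdmits
  where
    avoid : ∀ v u → ∃[ w ] (T (adj v w) × w ≢ u)
    avoid v = Darts.avoiding-neighbour adj (subst (2 ≤_) (sym (cubic v)) (s≤s (s≤s z≤n)))
    open TwoDartTransitiveGroup adj adj-sym connected col bipartition (fromℕ< 1≤n) avoid
                                G subgroup transitive
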